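{- $W(7,3) > 336$; that is, there exists a coloring of $\{1,2,\dots,336\}$ with $7$ colors containing no monochromatic arithmetic progression of length $3$.
   Context: For positive integers $r$ and $k$, the van der Waerden number $W(r,k)$ is the smallest positive integer $N$ such that for every coloring of the integers $\{1,2,\dots,N\}$ with $r$ colors there exist $k$ integers in arithmetic progression (with nonzero common difference) all of the same color. (Its existence is van der Waerden's theorem.) -}

module Defs where

open import Data.Nat using (ℕ; suc; _+_; _*_; _≤_; _∸_)
open import Data.Fin using (Fin)
open import Data.Product using (_×_)
open import Relation.Nullary using (¬_)
open import Relation.Binary.PropositionalEquality using (_≡_)

-- An r-coloring of {1,…,N} is given as a function ℕ → Fin r; only its values
-- on 1,…,N matter.
MonoAP : (r N k : ℕ) → (ℕ → Fin r) → ℕ → ℕ → Set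
MonoAP r N k c a d =
  (1 ≤ d) × (1 ≤ a) × (a + (k ∸ 1) * d ≤ N) ×
  (∀ i → i ≤ k ∸ 1 → c (a + i * d) ≡ c a)

APFree : (r N k : ℕ) → (ℕ → Fin r) → Set
APFree r N k c = ∀ a d → ¬ MonoAP r N k c a d

-- For k ≥ 2 every
-- progression inside {1,…,N} has a, d ≤ N, so AP-freeness reduces to a finite check,
-- which the type checker carries out by evaluation.
module Submission where

open import Defs
open import Data.Bool using (Bool; T)
open import Data.Bool.ListAction using (all)
open import Data.Fin using (Fin; _≟_)
open import Data.List using (downFrom)
open import Data.List.Membership.Propositional.Properties using (∈-downFrom⁺)
open import Data.List.Relation.Unary.All using (lookup)
open import Data.List.Relation.Unary.All.Properties using (all⁺)
open import Data.Nat using (ℕ; suc; _+_; _*_; _∸_; _≤_; _<_; _≤?_; _/_; s≤s; s≤s⁻¹; z≤n; allUpTo?)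
open import Data.Nat.DivMod using (_mod_)
open import Data.Nat.Properties using (≤-trans; m≤m+n; m≤n+m)
open import Data.Product using (Σ; _×_; _,_)
open import Data.Unit using (tt)
open import Data.Vec using (Vec; []; _∷_) renaming (lookup to _[_])
open import Function using (_∘_)
open import Relation.Nullary using (Dec)
open import Relation.Nullary.Decidable using (_×-dec_; map′; isNo; toWitnessFalse)

T-all-downFrom : ∀ (p : ℕ → Bool) n → T (all p (downFrom n)) → ∀ {i} → i < n → T (p i)
T-all-downFrom p n all-p i<n = lookup (all⁺ p (downFrom n) all-p) (∈-downFrom⁺ i<n)

monoAP? : ∀ {r} N k (c : ℕ → Fin r) a d → Dec (MonoAP r N k c a d)
monoAP? N k c a d =
  1 ≤? d ×-dec 1 ≤? a ×-dec a + (k ∸ 1) * d ≤? N ×-dec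
  map′ (λ mono i i≤ → mono (s≤s i≤)) (λ mono {i} i< → mono i (s≤s⁻¹ i<))
       (allUpTo? (λ i → c (a + i * d) ≟ c a) (suc (k ∸ 1)))

monoAP-bounded : ∀ {r N k c a d} → 2 ≤ k → MonoAP r N k c a d → a ≤ N × d ≤ N
monoAP-bounded {a = a} {d} (s≤s (s≤s _)) (_ , _ , end≤N , _) =
  ≤-trans (m≤m+n a _) end≤N ,
  ≤-trans (≤-trans (m≤m+n d _) (m≤n+m _ a)) end≤N

apFreeᵇ : ∀ {r} N k (c : ℕ → Fin r) → Bool
apFreeᵇ N k c = all (λ a → all (isNo ∘ monoAP? N k c a) (downFrom (suc N))) (downFrom (suc N))

apFreeᵇ-sound : ∀ {r N k} (c : ℕ → Fin r) → 2 ≤ k → T (apFreeᵇ N k c) → APFree r N k c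
apFreeᵇ-sound {N = N} {k} c 2≤k free a d mono
  with a≤N , d≤N ← monoAP-bounded {c = c} 2≤k mono =
  toWitnessFalse (T-all-downFrom (isNo ∘ monoAP? N k c a) (suc N) free-a (s≤s d≤N)) mono
  where
  free-a : T (all (isNo ∘ monoAP? N k c a) (downFrom (suc N)))
  free-a = T-all-downFrom _ (suc N) free (s≤s a≤N)

pattern24 : Vec ℕ 24
pattern24 = 0 ∷ 1 ∷ 5 ∷ 1 ∷ 0 ∷ 0 ∷ 1 ∷ 4 ∷ 1 ∷ 3 ∷ 3 ∷ 6 ∷ 0 ∷ 5 ∷ 0 ∷ 3 ∷ 3 ∷ 2 ∷ 0 ∷ 3 ∷ 5 ∷ 2 ∷ 1 ∷ 4 ∷ []

colouring : ℕ → Fin 7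
colouring x = (pattern24 [ x mod 24 ] + 2 * (x / 24)) mod 7

mainTheorem1 : Σ (ℕ → Fin 7) (λ c → APFree 7 336 3 c)
mainTheorem1 = colouring , apFreeᵇ-sound colouring (s≤s (s≤s z≤n)) tt
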